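{- Let $(N,*)$ be a group with identity $1$, and let $I$ be a permutation of $N$ with $I(1)=1$. Define $a+b=a*(Ib)^{ -1}$ and $a-b=a*b^{ -1}$. Then $(N,+,-)$ is a DFBQ in which $1$ is a right identity for $+$, $a-a=1$ for all $a$, and $a-1=a$ for all $a\in N$.
   Context: A DFBQ $(N,+,-)$ is a set $N$ with two binary operations $+$ and $-$ such that $(N,+)$ and $(N,-)$ are both quasigroups (for all $a,b$, the equations $a\circ x=b$ and $y\circ a=b$ have unique solutions) and $a-b=(a+c)-(b+c)$ for all $a,b,c\in N$. -}

module Defs where

open import Level using (Level; _⊔_)
open import Data.Product using (Σ; _×_; _,_)
open import Relation.Binary.Core using (Rel)
open import Algebra.Bundles using (Group)

private variable a ℓ : Level

∃!≈ : {A : Set a} → Rel A ℓ → (A → Set ℓ) → Set (a ⊔ ℓ)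
∃!≈ {A = A} _≈_ P = Σ A λ x → P x × (∀ y → P y → x ≈ y)

IsQuasigroupBySolutions : {A : Set a} → Rel A ℓ → (A → A → A) → Set (a ⊔ ℓ)
IsQuasigroupBySolutions {A = A} _≈_ _∘_ =
  (∀ p q → ∃!≈ _≈_ (λ x → (p ∘ x) ≈ q)) × (∀ p q → ∃!≈ _≈_ (λ y → (y ∘ p) ≈ q))

IsDFBQ : {A : Set a} → Rel A ℓ → (A → A → A) → (A → A → A) → Set (a ⊔ ℓ)
IsDFBQ {A = A} _≈_ _⊕_ _⊖_ =
  IsQuasigroupBySolutions _≈_ _⊕_ × IsQuasigroupBySolutions _≈_ _⊖_ ×
  (∀ p q r → (p ⊖ q) ≈ ((p ⊕ r) ⊖ (q ⊕ r)))

record IsPermutation {A : Set a} (_≈_ : Rel A ℓ) (f : A → A) : Set (a ⊔ ℓ) where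
  field
    cong    : ∀ {x y} → x ≈ y → f x ≈ f y
    inv     : A → A
    inv-cong : ∀ {x y} → x ≈ y → inv x ≈ inv y
    inverseˡ : ∀ x → f (inv x) ≈ x
    inverseʳ : ∀ x → inv (f x) ≈ x

module GroupOps {c ℓ} (G : Group c ℓ) (I : Group.Carrier G → Group.Carrier G) where
  open Group G
  _⊕_ : Carrier → Carrier → Carrier
  p ⊕ q = p ∙ (I q ⁻¹)
  _⊖_ : Carrier → Carrier → Carrier
  p ⊖ q = p ∙ (q ⁻¹)

module Submission where

open import Defs
open import Data.Product using (_×_; _,_)
open import Function using (_∘_)
open import Algebra.Bundles using (Group; Quasigroup)
open import Algebra.Core using (Op₂)
open import Algebra.Definitions using (LeftCongruent)
open import Relation.Binary.Bundles using (Setoid)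
import Algebra.Properties.Group as GroupProperties
import Relation.Binary.Reasoning.Setoid as SetoidReasoning

-- Both operations come from the group quasigroup (N, ∙) by permuting the
-- right argument: a - b = a ∙ b⁻¹ through b ↦ b⁻¹, and a + b = a - I b through I.
-- Permuting an argument preserves unique solvability, and the DFBQ law is the
-- cancellation (a ∙ c)(b ∙ c)⁻¹ = a b⁻¹ with c = (I r)⁻¹.

Quasigroup⇒IsQuasigroupBySolutions : ∀ {c ℓ} (Q : Quasigroup c ℓ) →
  IsQuasigroupBySolutions (Quasigroup._≈_ Q) (Quasigroup._∙_ Q)
Quasigroup⇒IsQuasigroupBySolutions Q = leftSolution , rightSolution
  where
  open Quasigroup Q

  leftSolution : ∀ p q → ∃!≈ _≈_ (λ x → (p ∙ x) ≈ q)
  leftSolution p q = p \\ q , leftDividesˡ p q ,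
    λ x px≈q → trans (\\-congˡ (sym px≈q)) (leftDividesʳ p x)

  rightSolution : ∀ p q → ∃!≈ _≈_ (λ y → (y ∙ p) ≈ q)
  rightSolution p q = q // p , rightDividesˡ p q ,
    λ y yp≈q → trans (//-congʳ (sym yp≈q)) (rightDividesʳ p y)

module _ {a ℓ} (S : Setoid a ℓ) where
  open Setoid S

  permuteʳ-isQuasigroupBySolutions : {_∘_ : Op₂ Carrier} → LeftCongruent _≈_ _∘_ →
    IsQuasigroupBySolutions _≈_ _∘_ →
    {f : Carrier → Carrier} → IsPermutation _≈_ f →
    IsQuasigroupBySolutions _≈_ (λ p q → p ∘ f q)
  permuteʳ-isQuasigroupBySolutions {_∘_} ∘-congˡ (leftSolution , rightSolution) {f} perm =
    leftSolutionᶠ , λ p → rightSolution (f p)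
    where
    module P = IsPermutation perm
    open SetoidReasoning S

    leftSolutionᶠ : ∀ p q → ∃!≈ _≈_ (λ x → (p ∘ f x) ≈ q)
    leftSolutionᶠ p q with leftSolution p q
    ... | s , ps≈q , unique = P.inv s , trans (∘-congˡ (P.inverseˡ s)) ps≈q , λ x pfx≈q → begin
      P.inv s     ≈⟨ P.inv-cong (unique (f x) pfx≈q) ⟩
      P.inv (f x) ≈⟨ P.inverseʳ x ⟩
      x           ∎

module _ {c ℓ} (G : Group c ℓ) where
  open Group G
  open GroupProperties G
  open SetoidReasoning setoid

  ⁻¹-isPermutation : IsPermutation _≈_ _⁻¹
  ⁻¹-isPermutation = record
    { cong     = ⁻¹-cong
    ; inv      = _⁻¹
    ; inv-cong = ⁻¹-cong
    ; inverseˡ = ⁻¹-involutive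
    ; inverseʳ = ⁻¹-involutive
    }

  x∙y⁻¹-isQuasigroupBySolutions : IsQuasigroupBySolutions _≈_ (λ x y → x ∙ y ⁻¹)
  x∙y⁻¹-isQuasigroupBySolutions = permuteʳ-isQuasigroupBySolutions setoid ∙-congˡ
    (Quasigroup⇒IsQuasigroupBySolutions quasigroup) ⁻¹-isPermutation

  [x∙z]∙[y∙z]⁻¹≈x∙y⁻¹ : ∀ x y z → (x ∙ z) ∙ (y ∙ z) ⁻¹ ≈ x ∙ y ⁻¹
  [x∙z]∙[y∙z]⁻¹≈x∙y⁻¹ x y z = begin
    (x ∙ z) ∙ (y ∙ z) ⁻¹     ≈⟨ ∙-congˡ (⁻¹-anti-homo-∙ y z) ⟩
    (x ∙ z) ∙ (z ⁻¹ ∙ y ⁻¹)  ≈⟨ assoc x z _ ⟩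
    x ∙ (z ∙ (z ⁻¹ ∙ y ⁻¹))  ≈⟨ ∙-congˡ (\\-leftDividesˡ z (y ⁻¹)) ⟩
    x ∙ y ⁻¹                 ∎

  x∙ε⁻¹≈x : ∀ x → x ∙ ε ⁻¹ ≈ x
  x∙ε⁻¹≈x x = trans (∙-congˡ ε⁻¹≈ε) (identityʳ x)

mainTheorem9 : ∀ {c ℓ} (G : Group c ℓ) (I : Group.Carrier G → Group.Carrier G) →
    IsPermutation (Group._≈_ G) I → Group._≈_ G (I (Group.ε G)) (Group.ε G) →
    IsDFBQ (Group._≈_ G) (GroupOps._⊕_ G I) (GroupOps._⊖_ G I) ×
    (∀ x → Group._≈_ G (GroupOps._⊕_ G I x (Group.ε G)) x) ×
    (∀ x → Group._≈_ G (GroupOps._⊖_ G I x x) (Group.ε G)) ×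
    (∀ x → Group._≈_ G (GroupOps._⊖_ G I x (Group.ε G)) x)
mainTheorem9 G I I-perm Iε≈ε =
  ((⊕-quasigroup , x∙y⁻¹-isQuasigroupBySolutions G , ⊖-invariant) ,
   ε-rightIdentity-⊕ , inverseʳ , x∙ε⁻¹≈x G)
  where
  open Group G

  ⊕-quasigroup : IsQuasigroupBySolutions _≈_ (GroupOps._⊕_ G I)
  ⊕-quasigroup = permuteʳ-isQuasigroupBySolutions setoid (∙-congˡ ∘ ⁻¹-cong)
    (x∙y⁻¹-isQuasigroupBySolutions G) I-perm

  ⊖-invariant : ∀ p q r → p ∙ q ⁻¹ ≈ (p ∙ I r ⁻¹) ∙ (q ∙ I r ⁻¹) ⁻¹
  ⊖-invariant p q r = sym ([x∙z]∙[y∙z]⁻¹≈x∙y⁻¹ G p q (I r ⁻¹))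

  ε-rightIdentity-⊕ : ∀ x → x ∙ I ε ⁻¹ ≈ x
  ε-rightIdentity-⊕ x = trans (∙-congˡ (⁻¹-cong Iε≈ε)) (x∙ε⁻¹≈x G x)
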